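{- Let $(T,L,c,r)$ be a rooted WDTAP instance, let $x$ be a feasible solution to the LP $\min\{c^\top x: Mx\ge\mathbf 1,x\ge 0\}$, let $\sigma$ be a splitting of $L$ and let $x'=\mathrm{split}(x,\sigma)$. Then for every vertex $v$, the visible up-width (resp. visible down-width) of $v$ with respect to $\mathrm{supp}(x')$ is at most the visible up-width (resp. visible down-width) of $v$ with respect to $\mathrm{supp}(x)$.
   Context: WDTAP instance: oriented tree $T=(V,A)$, links $L\subseteq V\times V$, costs $c\colon L\to\mathbb{R}_{>0}$. For $\ell=(u,v)$, $P_\ell$ is the $u$-$v$ path in the underlying undirected tree traversed from $u$ to $v$, and $\overrightarrow{\mathrm{cov}}(\ell)$ is the set of its arcs traversed against their orientation. $M_{a,\ell}=1$ iff $a\in\overrightarrow{\mathrm{cov}}(\ell)$. $\mathrm{supp}(x)=\{\ell:x_\ell>0\}$. A shadow of $\ell=(u,v)$ is a link $(u',v')$ with $u',v'$ on $P_\ell$, $u'$ before $v'$ from $u$ to $v$. A splitting of $L$ is a map $\sigma\colon L\to 2^L$ sending each $\ell$ to a set of shadows of $\ell$ whose paths partition the arc set of $P_\ell$; $\mathrm{split}(x,\sigma)_{\ell'}=\sum_{\ell:\ell'\in\sigma(\ell)}x_\ell$. Rooted: root $r$; up-arcs point towards $r$, down-arcs away; $T_v=(U_v,A_v)$ is the subtree of descendants of $v$. $\overline{P}_\ell$ is the shortest subpath of $P_\ell$ containing $\overrightarrow{\mathrm{cov}}(\ell)$; $\mathrm{in}(P)$ = inner vertices of $P$. An arc $a\in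 A_v$ is visible to $v$ w.r.t. $L'$ if some $\ell\in L'$ has $a\in\overrightarrow{\mathrm{cov}}(\ell)$ and $v\in\mathrm{in}(\overline{P}_\ell)$. For an arc $a$, $\mathrm{apex}(a)$ is its endpoint closer to $r$; $F\subseteq A$ is ancestor-free if no $a,a'\in F$ have $a'$ on the $\mathrm{apex}(a)$-$r$ path. The visible up-width (down-width) of $v$ w.r.t. $L'$ is the maximum size of an ancestor-free set of up-arcs (down-arcs) visible to $v$ w.r.t. $L'$.
   Formalization: The costs c and the feasible LP solution x take values in ℚ instead of ℝ. -}

module Defs where

open import Data.Nat using (ℕ; zero; suc; _∸_) renaming (_≤_ to _≤ℕ_; _<_ to _<ℕ_)
open import Data.Fin using (Fin; zero; suc; toℕ; inject₁; fromℕ)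
open import Data.Fin.Subset using (Subset; _∈_; ∣_∣)
open import Data.Vec using (lookup)
open import Data.Bool using (Bool; true; false; if_then_else_)
open import Data.Product using (Σ; ∃; ∃-syntax; _×_; _,_)
open import Data.Sum using (_⊎_)
open import Relation.Nullary using (¬_)
open import Relation.Binary.PropositionalEquality using (_≡_; _≢_)
open import Data.Rational using (ℚ; 0ℚ; 1ℚ; _+_; _*_) renaming (_≤_ to _≤ℚ_; _<_ to _<ℚ_)

iter : ∀ {A : Set} → (A → A) → ℕ → A → A
iter f zero    a = a
iter f (suc k) a = f (iter f k a)

sumℚ : ∀ {m} → (Fin m → ℚ) → ℚ
sumℚ {zero}  f = 0ℚ
sumℚ {suc m} f = f zero + sumℚ (λ i → f (suc i))

-- The oriented tree, rooted at `root`, is encoded by a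
-- parent function: every non-root vertex c has exactly one tree arc between
-- c and parent c; we identify that arc with its lower endpoint (child) c.
-- `upward c ≡ true` means the arc is oriented c → parent c (an up-arc,
-- pointing towards the root); `false` means parent c → c (a down-arc).
-- Links are indexed by Fin m with endpoints `ends`, injective (L is a set
-- of ordered pairs), with positive costs.

record Instance (n m : ℕ) : Set where
  field
    root         : Fin n
    parent       : Fin n → Fin n
    parent-root  : parent root ≡ root
    reaches-root : ∀ v → ∃[ k ] iter parent k v ≡ root
    upward       : Fin n → Bool
    tail head    : Fin m → Fin n
    ends-inj     : ∀ ℓ ℓ' → tail ℓ ≡ tail ℓ' → head ℓ ≡ head ℓ' → ℓ ≡ ℓ'
    cost         : Fin m → ℚ
    cost-pos     : ∀ ℓ → 0ℚ <ℚ cost ℓ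

module _ {n m : ℕ} (I : Instance n m) where
  open Instance I

  IsArc : Fin n → Set
  IsArc c = c ≢ root

  ArcOfStep : Fin n → Fin n → Fin n → Set
  ArcOfStep a b c = (c ≡ a × a ≢ root × parent a ≡ b)
                  ⊎ (c ≡ b × b ≢ root × parent b ≡ a)

  Adjacent : Fin n → Fin n → Set
  Adjacent a b = ∃[ c ] ArcOfStep a b c

  CoveredStep : Fin n → Fin n → Fin n → Set
  CoveredStep a b c = (c ≡ a × a ≢ root × parent a ≡ b × upward a ≡ false)
                    ⊎ (c ≡ b × b ≢ root × parent b ≡ a × upward b ≡ true)

  record IsPath (u v : Fin n) (k : ℕ) (p : Fin (suc k) → Fin n) : Set where
    field
      start  : p zero ≡ u
      end    : p (fromℕ k) ≡ v
      steps  : ∀ (s : Fin k) → Adjacent (p (inject₁ s)) (p (suc s))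
      simple : ∀ i j → p i ≡ p j → i ≡ j

  IsLinkPath : Fin m → (k : ℕ) → (Fin (suc k) → Fin n) → Set
  IsLinkPath ℓ = IsPath (tail ℓ) (head ℓ)

  ArcOfLink : Fin m → Fin n → Set
  ArcOfLink ℓ c = ∃[ k ] Σ (Fin (suc k) → Fin n) λ p → IsLinkPath ℓ k p ×
                  ∃[ s ] ArcOfStep (p (inject₁ s)) (p (suc s)) c

  InCov : Fin m → Fin n → Set
  InCov ℓ c = ∃[ k ] Σ (Fin (suc k) → Fin n) λ p → IsLinkPath ℓ k p ×
              ∃[ s ] CoveredStep (p (inject₁ s)) (p (suc s)) c

  IsCoverageMatrix : (Fin n → Fin m → ℚ) → Set
  IsCoverageMatrix M = ∀ c ℓ → (InCov ℓ c → M c ℓ ≡ 1ℚ) × (¬ InCov ℓ c → M c ℓ ≡ 0ℚ)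

  Feasible : (Fin n → Fin m → ℚ) → (Fin m → ℚ) → Set
  Feasible M x = (∀ ℓ → 0ℚ ≤ℚ x ℓ)
               × (∀ c → IsArc c → 1ℚ ≤ℚ sumℚ (λ ℓ → M c ℓ * x ℓ))

  supp : (Fin m → ℚ) → Fin m → Set
  supp x ℓ = 0ℚ <ℚ x ℓ

  Shadow : Fin m → Fin m → Set
  Shadow ℓ' ℓ = ∃[ k ] Σ (Fin (suc k) → Fin n) λ p → IsLinkPath ℓ k p ×
                ∃[ i ] ∃[ j ] (toℕ i <ℕ toℕ j × p i ≡ tail ℓ' × p j ≡ head ℓ')

  IsSplitting : (Fin m → Subset m) → Set
  IsSplitting σ = ∀ ℓ →
      (∀ ℓ' → ℓ' ∈ σ ℓ → Shadow ℓ' ℓ)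
    × (∀ ℓ' → ℓ' ∈ σ ℓ → ∀ c → ArcOfLink ℓ' c → ArcOfLink ℓ c)
    × (∀ c → ArcOfLink ℓ c → ∃[ ℓ' ] (ℓ' ∈ σ ℓ × ArcOfLink ℓ' c))
    × (∀ ℓ₁ ℓ₂ → ℓ₁ ∈ σ ℓ → ℓ₂ ∈ σ ℓ → ∀ c → ArcOfLink ℓ₁ c → ArcOfLink ℓ₂ c → ℓ₁ ≡ ℓ₂)

  split : (Fin m → ℚ) → (Fin m → Subset m) → Fin m → ℚ
  split x σ ℓ' = sumℚ (λ ℓ → if lookup (σ ℓ) ℓ' then x ℓ else 0ℚ)

  CovSubpath : (k : ℕ) → (Fin (suc k) → Fin n) → Fin (suc k) → Fin (suc k) → Set
  CovSubpath k p i j = toℕ i ≤ℕ toℕ j ×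
    (∀ (s : Fin k) c → CoveredStep (p (inject₁ s)) (p (suc s)) c →
       toℕ i ≤ℕ toℕ s × suc (toℕ s) ≤ℕ toℕ j)

  ShortestCovSubpath : (k : ℕ) → (Fin (suc k) → Fin n) → Fin (suc k) → Fin (suc k) → Set
  ShortestCovSubpath k p i j = CovSubpath k p i j ×
    (∀ i' j' → CovSubpath k p i' j' → toℕ j ∸ toℕ i ≤ℕ toℕ j' ∸ toℕ i')

  InnerOfBar : Fin m → Fin n → Set
  InnerOfBar ℓ v = ∃[ k ] Σ (Fin (suc k) → Fin n) λ p → IsLinkPath ℓ k p ×
    ∃[ i ] ∃[ j ] (ShortestCovSubpath k p i j ×
      ∃[ t ] (toℕ i <ℕ toℕ t × toℕ t <ℕ toℕ j × p t ≡ v))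

  Descendant : Fin n → Fin n → Set
  Descendant w v = ∃[ k ] iter parent k w ≡ v

  ArcInSubtree : Fin n → Fin n → Set
  ArcInSubtree v c = IsArc c × Descendant c v × Descendant (parent c) v

  Visible : (Fin m → Set) → Fin n → Fin n → Set
  Visible L' v c = ArcInSubtree v c × ∃[ ℓ ] (L' ℓ × InCov ℓ c × InnerOfBar ℓ v)

  UpArc DownArc : Fin n → Set
  UpArc c   = IsArc c × upward c ≡ true
  DownArc c = IsArc c × upward c ≡ false

  apex : Fin n → Fin n
  apex c = parent c

  OnRootPath : Fin n → Fin n → Set
  OnRootPath a' w = IsArc a' × ∃[ k ] iter parent k w ≡ a'

  AncestorFree : Subset n → Set
  AncestorFree F = ∀ a a' → a ∈ F → a' ∈ F → ¬ OnRootPath a' (apex a)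

  Admissible : (Fin n → Set) → (Fin m → Set) → Fin n → Subset n → Set
  Admissible K L' v F = (∀ c → c ∈ F → K c × Visible L' v c) × AncestorFree F

  IsVisibleWidth : (Fin n → Set) → (Fin m → Set) → Fin n → ℕ → Set
  IsVisibleWidth K L' v w =
    (∃[ F ] (Admissible K L' v F × ∣ F ∣ ≡ w))
    × (∀ F → Admissible K L' v F → ∣ F ∣ ≤ℕ w)

  IsVisibleUpWidth IsVisibleDownWidth : (Fin m → Set) → Fin n → ℕ → Set
  IsVisibleUpWidth   = IsVisibleWidth UpArc
  IsVisibleDownWidth = IsVisibleWidth DownArc

{-# OPTIONS --safe #-}
module Submission where

-- A link ℓ′ with split(x, σ)ℓ′ > 0 lies in σ(ℓ) for some ℓ with xℓ > 0, so it is a shadow of ℓ.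
-- Tree paths are unique (a simple path climbs to its highest vertex, then descends), so P_ℓ′
-- is a piece of P_ℓ and every arc ℓ′ covers is covered by ℓ.  A vertex is inside P̄ exactly
-- when covered steps of the path lie both before and after it, which persists when the piece
-- is placed inside P_ℓ.  Hence every arc visible to v w.r.t. supp(split(x, σ)) is visible
-- w.r.t. supp(x), so admissible sets for the former are admissible for the latter.

open import Defs
open import Data.Nat using (ℕ; zero; suc; _+_; _*_; _∸_; _≤_; _<_; z≤n; s≤s; _≤?_; _<?_)
open import Data.Nat.Properties
open import Data.Fin using (Fin; zero; suc; toℕ; inject₁; fromℕ; fromℕ<)
import Data.Fin.Properties as Fin
open import Data.Fin.Subset using (Subset)
open import Data.Product using (Σ; ∃; ∃-syntax; _×_; _,_; proj₁; proj₂)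
open import Data.Sum using (_⊎_; inj₁; inj₂)
open import Data.Bool using (true; false)
import Data.Bool as Bool
open import Data.Vec using (lookup)
open import Data.Vec.Properties using (lookup⇒[]=)
open import Data.Rational using (ℚ; 0ℚ) renaming (_<_ to _<ℚ_; _≤_ to _≤ℚ_)
import Data.Rational.Properties as ℚ
open import Function using (_∘_)
open import Relation.Nullary using (¬_; Dec; yes; no; contradiction)
open import Relation.Nullary.Decidable using (_×-dec_; _⊎-dec_; ¬?; map′)
open import Relation.Unary using (Pred; Decidable)
open import Relation.Binary.PropositionalEquality

sumℚ-nonpos : ∀ {m} (f : Fin m → ℚ) → (∀ i → f i ≤ℚ 0ℚ) → sumℚ f ≤ℚ 0ℚ
sumℚ-nonpos {zero}  f f≤0 = ℚ.≤-refl
sumℚ-nonpos {suc m} f f≤0 = ℚ.+-mono-≤ (f≤0 zero) (sumℚ-nonpos (f ∘ suc) (f≤0 ∘ suc))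

sumℚ-pos⇒∃-pos : ∀ {m} (f : Fin m → ℚ) → 0ℚ <ℚ sumℚ f → ∃[ i ] 0ℚ <ℚ f i
sumℚ-pos⇒∃-pos f pos with Fin.any? (λ i → 0ℚ ℚ.<? f i)
... | yes found = found
... | no none = contradiction (ℚ.<-≤-trans pos (sumℚ-nonpos f f≤0)) (ℚ.<-irrefl refl)
  where
  f≤0 : ∀ i → f i ≤ℚ 0ℚ
  f≤0 i = ℚ.≮⇒≥ (λ 0<fi → none (i , 0<fi))

least : ∀ {k p} {S : Pred (Fin k) p} → Decidable S → ∃ S →
        ∃[ a ] S a × (∀ s → S s → toℕ a ≤ toℕ s)
least {suc k} S? (zero , S0) = zero , S0 , λ _ _ → z≤n
least {suc k} S? (suc s , Ss) with S? zero
... | yes S0 = zero , S0 , λ _ _ → z≤n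
... | no ¬S0 with least (S? ∘ suc) (s , Ss)
...   | a , Sa , a-least = suc a , Sa , λ where
          zero    S0 → contradiction S0 ¬S0
          (suc s) Ss → s≤s (a-least s Ss)

greatest : ∀ {k p} {S : Pred (Fin k) p} → Decidable S → ∃ S →
           ∃[ b ] S b × (∀ s → S s → toℕ s ≤ toℕ b)
greatest {suc k} S? (s , Ss) with Fin.any? (S? ∘ suc)
... | yes found with greatest (S? ∘ suc) found
...   | b , Sb , b-greatest = suc b , Sb , λ where
          zero    _  → z≤n
          (suc s) Ss → s≤s (b-greatest s Ss)
greatest {suc k} S? (zero , S0)  | no none =
  zero , S0 , λ where
    zero    _  → z≤n
    (suc s) Ss → contradiction (s , Ss) none
greatest {suc k} S? (suc s , Ss) | no none = contradiction (s , Ss) none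

-- R s c: step s of a k-step walk covers c.  Taking a relation rather than a predicate on
-- steps makes Covers and Tightest unfold to CovSubpath and ShortestCovSubpath.
module _ {k : ℕ} {C : Set} (R : Fin k → C → Set) where

  Marked : Fin k → Set
  Marked s = ∃ (R s)

  Covers : Fin (suc k) → Fin (suc k) → Set
  Covers i j = toℕ i ≤ toℕ j × (∀ s c → R s c → toℕ i ≤ toℕ s × suc (toℕ s) ≤ toℕ j)

  Tightest : Fin (suc k) → Fin (suc k) → Set
  Tightest i j = Covers i j × (∀ i′ j′ → Covers i′ j′ → toℕ j ∸ toℕ i ≤ toℕ j′ ∸ toℕ i′)

  Straddles : Fin (suc k) → Set
  Straddles t = (∃[ s ] Marked s × toℕ s < toℕ t) × (∃[ s ] Marked s × toℕ t ≤ toℕ s)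

  module _ (marked? : Decidable Marked) where

    -- If no marked step preceded (followed) t, the interval could be shrunk to start (end) at t.
    tightest-inner⇒straddles : ∀ {i j t} → Tightest i j → toℕ i < toℕ t → toℕ t < toℕ j → Straddles t
    tightest-inner⇒straddles {i} {j} {t} ((_ , covers) , tightest) i<t t<j = before , after
      where
      before : ∃[ s ] Marked s × toℕ s < toℕ t
      before with Fin.any? (λ s → marked? s ×-dec toℕ s <? toℕ t)
      ... | yes found = found
      ... | no none = contradiction (tightest t j (<⇒≤ t<j , from-t)) (<⇒≱ (∸-monoʳ-< i<t (<⇒≤ t<j)))
        where
        from-t : ∀ s c → R s c → toℕ t ≤ toℕ s × suc (toℕ s) ≤ toℕ j
        from-t s c Rsc = ≮⇒≥ (λ s<t → none (s , (c , Rsc) , s<t)) , proj₂ (covers s c Rsc)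
      after : ∃[ s ] Marked s × toℕ t ≤ toℕ s
      after with Fin.any? (λ s → marked? s ×-dec toℕ t ≤? toℕ s)
      ... | yes found = found
      ... | no none = contradiction (tightest i t (<⇒≤ i<t , up-to-t)) (<⇒≱ (∸-monoˡ-< t<j (<⇒≤ i<t)))
        where
        up-to-t : ∀ s c → R s c → toℕ i ≤ toℕ s × suc (toℕ s) ≤ toℕ t
        up-to-t s c Rsc = proj₁ (covers s c Rsc) , ≰⇒> (λ t≤s → none (s , (c , Rsc) , t≤s))

    -- The tightest interval runs from the first marked step to the end of the last one.
    straddles⇒tightest-inner : ∀ {t} → Straddles t →
      ∃[ i ] ∃[ j ] Tightest i j × toℕ i < toℕ t × toℕ t < toℕ j
    straddles⇒tightest-inner {t} ((s₁ , m₁ , s₁<t) , (s₂ , m₂ , t≤s₂))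
      with least marked? (s₁ , m₁) | greatest marked? (s₂ , m₂)
    ... | a , (c , Rac) , a-least | b , (c′ , Rbc′) , b-greatest =
      inject₁ a , suc b , ((first≤last , covers) , tightest) ,
      ≤-<-trans (a-first s₁ m₁) s₁<t , s≤s (≤-trans t≤s₂ (b-greatest s₂ m₂))
      where
      a-first : ∀ s → Marked s → toℕ (inject₁ a) ≤ toℕ s
      a-first s ms rewrite Fin.toℕ-inject₁ a = a-least s ms
      first≤last : toℕ (inject₁ a) ≤ suc (toℕ b)
      first≤last = m≤n⇒m≤1+n (a-first b (c′ , Rbc′))
      covers : ∀ s c → R s c → toℕ (inject₁ a) ≤ toℕ s × suc (toℕ s) ≤ suc (toℕ b)
      covers s c Rsc = a-first s (c , Rsc) , s≤s (b-greatest s (c , Rsc))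
      tightest : ∀ i′ j′ → Covers i′ j′ → suc (toℕ b) ∸ toℕ (inject₁ a) ≤ toℕ j′ ∸ toℕ i′
      tightest i′ j′ (_ , covers′) rewrite Fin.toℕ-inject₁ a =
        ∸-mono (proj₂ (covers′ b c′ Rbc′)) (proj₁ (covers′ a c Rac))

module ParentTree {A : Set} (parent : A → A) (root : A)
                  (parent-root : parent root ≡ root)
                  (reaches-root : ∀ v → ∃[ k ] iter parent k v ≡ root) where

  ancestor : ℕ → A → A
  ancestor = iter parent

  ancestor-+ : ∀ a b x → ancestor (a + b) x ≡ ancestor a (ancestor b x)
  ancestor-+ zero    b x = refl
  ancestor-+ (suc a) b x = cong parent (ancestor-+ a b x)

  ancestor-∸ : ∀ {a b} → a ≤ b → ∀ x → ancestor b x ≡ ancestor (b ∸ a) (ancestor a x)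
  ancestor-∸ {a} {b} a≤b x =
    trans (cong (λ e → ancestor e x) (sym (m∸n+n≡m a≤b))) (ancestor-+ (b ∸ a) a x)

  ancestor-parent : ∀ k x → ancestor k (parent x) ≡ ancestor (suc k) x
  ancestor-parent k x = trans (sym (ancestor-+ k 1 x)) (cong (λ e → ancestor e x) (+-comm k 1))

  ancestor-root : ∀ a → ancestor a root ≡ root
  ancestor-root zero    = refl
  ancestor-root (suc a) = trans (cong parent (ancestor-root a)) parent-root

  ancestor-periodic : ∀ d x → ancestor d x ≡ x → ∀ q → ancestor (q * d) x ≡ x
  ancestor-periodic d x loop zero    = refl
  ancestor-periodic d x loop (suc q) = begin
    ancestor (d + q * d) x          ≡⟨ ancestor-+ d (q * d) x ⟩
    ancestor d (ancestor (q * d) x) ≡⟨ cong (ancestor d) (ancestor-periodic d x loop q) ⟩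
    ancestor d x                    ≡⟨ loop ⟩
    x                               ∎
    where open ≡-Reasoning

  -- Going around the loop K times, where K is the depth of x, lands at the root.
  ancestor-loop⇒root : ∀ d x → 0 < d → ancestor d x ≡ x → x ≡ root
  ancestor-loop⇒root d@(suc _) x _ loop with reaches-root x
  ... | K , reaches = begin
    x                                   ≡⟨ sym (ancestor-periodic d x loop K) ⟩
    ancestor (K * d) x                  ≡⟨ ancestor-∸ (m≤m*n K d) x ⟩
    ancestor (K * d ∸ K) (ancestor K x) ≡⟨ cong (ancestor (K * d ∸ K)) reaches ⟩
    ancestor (K * d ∸ K) root           ≡⟨ ancestor-root (K * d ∸ K) ⟩
    root                                ∎
    where open ≡-Reasoning

  mutual-ancestors⇒root : ∀ {x y} p q → 0 < q → ancestor p x ≡ y → ancestor q y ≡ x → x ≡ root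
  mutual-ancestors⇒root {x} p q 0<q x↑y y↑x = ancestor-loop⇒root (q + p) x
    (<-≤-trans 0<q (m≤m+n q p))
    (trans (ancestor-+ q p x) (trans (cong (ancestor q) x↑y) y↑x))

  Adj : A → A → Set
  Adj a b = parent a ≡ b ⊎ parent b ≡ a

  record SimplePath (u v : A) (k : ℕ) (f : ℕ → A) : Set where
    field
      start  : f 0 ≡ u
      end    : f k ≡ v
      steps  : ∀ t → t < k → Adj (f t) (f (suc t))
      simple : ∀ t t′ → t ≤ k → t′ ≤ k → f t ≡ f t′ → t ≡ t′

  drop-first : ∀ {u v k f} → SimplePath u v (suc k) f → SimplePath (f 1) v k (f ∘ suc)
  drop-first P = record
    { start  = refl
    ; end    = end
    ; steps  = λ t t<k → steps (suc t) (s≤s t<k)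
    ; simple = λ t t′ t≤k t′≤k eq → suc-injective (simple (suc t) (suc t′) (s≤s t≤k) (s≤s t′≤k) eq)
    }
    where open SimplePath P

  slice : ∀ {u v k f} → SimplePath u v k f → ∀ {a b} → a ≤ b → b ≤ k →
          SimplePath (f a) (f b) (b ∸ a) (λ t → f (a + t))
  slice {f = f} P {a} {b} a≤b b≤k = record
    { start  = cong f (+-identityʳ a)
    ; end    = cong f (m+[n∸m]≡n a≤b)
    ; steps  = λ t t<b∸a → subst (λ e → Adj (f (a + t)) (f e)) (sym (+-suc a t))
                 (steps (a + t) (≤-trans (subst (_≤ b) (+-suc a t) (shift (suc t) t<b∸a)) b≤k))
    ; simple = λ t t′ t≤ t′≤ eq → +-cancelˡ-≡ a t t′
                 (simple (a + t) (a + t′) (≤-trans (shift t t≤) b≤k) (≤-trans (shift t′ t′≤) b≤k) eq)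
    }
    where
    open SimplePath P
    shift : ∀ t → t ≤ b ∸ a → a + t ≤ b
    shift t t≤ = subst (a + t ≤_) (m+[n∸m]≡n a≤b) (+-monoʳ-≤ a t≤)

  record UpDown (u v : A) (k : ℕ) (f : ℕ → A) (i : ℕ) : Set where
    field
      peak≤k : i ≤ k
      up     : ∀ t → t ≤ i → f t ≡ ancestor t u
      down   : ∀ t → t ≤ k ∸ i → f (k ∸ t) ≡ ancestor t v

  upDown-cons-up : ∀ {u v k f i} → f 0 ≡ u → parent (f 0) ≡ f 1 →
                   UpDown (f 1) v k (f ∘ suc) i → UpDown u v (suc k) f (suc i)
  upDown-cons-up {u} {v} {k} {f} {i} start climbs D = record
    { peak≤k = s≤s peak≤k
    ; up     = up′
    ; down   = λ t t≤k∸i → trans (cong f (+-∸-assoc 1 (≤-trans t≤k∸i (m∸n≤m k i)))) (down t t≤k∸i)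
    }
    where
    open UpDown D
    up′ : ∀ t → t ≤ suc i → f t ≡ ancestor t u
    up′ zero    _         = start
    up′ (suc t) (s≤s t≤i) = begin
      f (suc t)             ≡⟨ up t t≤i ⟩
      ancestor t (f 1)      ≡⟨ cong (ancestor t) (trans (sym climbs) (cong parent start)) ⟩
      ancestor t (parent u) ≡⟨ ancestor-parent t u ⟩
      ancestor (suc t) u    ∎
      where open ≡-Reasoning

  upDown-cons-down : ∀ {u v k f} → f 0 ≡ u → parent (f 1) ≡ f 0 →
                     UpDown (f 1) v k (f ∘ suc) 0 → UpDown u v (suc k) f 0
  upDown-cons-down {u} {v} {k} {f} start descends D = record
    { peak≤k = z≤n
    ; up     = λ where zero _ → start
    ; down   = down′
    }
    where
    open UpDown D
    down′ : ∀ t → t ≤ suc k → f (suc k ∸ t) ≡ ancestor t v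
    down′ t t≤1+k with m≤n⇒m<n∨m≡n t≤1+k
    ... | inj₁ (s≤s t≤k) = trans (cong f (+-∸-assoc 1 t≤k)) (down t t≤k)
    ... | inj₂ refl = begin
      f (suc k ∸ suc k)        ≡⟨ cong f (n∸n≡0 k) ⟩
      f 0                      ≡⟨ sym descends ⟩
      parent (f 1)             ≡⟨ cong (parent ∘ f ∘ suc) (sym (n∸n≡0 k)) ⟩
      parent (f (suc (k ∸ k))) ≡⟨ cong parent (down k ≤-refl) ⟩
      ancestor (suc k) v       ∎
      where open ≡-Reasoning

  -- A simple path cannot go down and then up again: that would revisit its first vertex.
  simplePath⇒upDown : ∀ k {u v f} → SimplePath u v k f → ∃[ i ] UpDown u v k f i
  simplePath⇒upDown zero P = 0 , record
    { peak≤k = z≤n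
    ; up     = λ where zero _ → SimplePath.start P
    ; down   = λ where zero _ → SimplePath.end P
    }
  simplePath⇒upDown (suc k) P
    with simplePath⇒upDown k (drop-first P) | SimplePath.steps P 0 (s≤s z≤n)
  ... | i     , D | inj₁ climbs    = suc i , upDown-cons-up (SimplePath.start P) climbs D
  ... | zero  , D | inj₂ descends  = 0 , upDown-cons-down (SimplePath.start P) descends D
  ... | suc _ , D | inj₂ descends  =
    contradiction (SimplePath.simple P 2 0 (s≤s (≤-trans (s≤s z≤n) (UpDown.peak≤k D))) z≤n
                     (trans (UpDown.up D 1 (s≤s z≤n)) descends)) λ ()

  upDown-meet : ∀ {u v k f i} → UpDown u v k f i → ancestor i u ≡ ancestor (k ∸ i) v
  upDown-meet {f = f} D = trans (sym (up _ ≤-refl)) (trans (cong f (sym (m∸[m∸n]≡n peak≤k))) (down _ ≤-refl))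
    where open UpDown D

  -- The a-th ancestor of u and the peak f i are ancestors of each other, so both are the root.
  upDown-overshoot : ∀ {u v k f i} → UpDown u v k f i →
                     ∀ {a b} → a ≤ i → k ∸ i < b → ancestor a u ≡ ancestor b v → f a ≡ f i
  upDown-overshoot {u} {v} {k} {f} {i} D {a} {b} a≤i k∸i<b meet = begin
    f a                             ≡⟨ up a a≤i ⟩
    ancestor a u                    ≡⟨ x≡root ⟩
    root                            ≡⟨ sym (ancestor-root (i ∸ a)) ⟩
    ancestor (i ∸ a) root           ≡⟨ cong (ancestor (i ∸ a)) (sym x≡root) ⟩
    ancestor (i ∸ a) (ancestor a u) ≡⟨ x↑y ⟩
    ancestor i u                    ≡⟨ sym (up i ≤-refl) ⟩
    f i                             ∎
    where
    open ≡-Reasoning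
    open UpDown D
    x↑y : ancestor (i ∸ a) (ancestor a u) ≡ ancestor i u
    x↑y = sym (ancestor-∸ a≤i u)
    y↑x : ancestor (b ∸ (k ∸ i)) (ancestor i u) ≡ ancestor a u
    y↑x = begin
      ancestor (b ∸ (k ∸ i)) (ancestor i u)       ≡⟨ cong (ancestor (b ∸ (k ∸ i))) (upDown-meet D) ⟩
      ancestor (b ∸ (k ∸ i)) (ancestor (k ∸ i) v) ≡⟨ sym (ancestor-∸ (<⇒≤ k∸i<b) v) ⟩
      ancestor b v                                ≡⟨ sym meet ⟩
      ancestor a u                                ∎
    x≡root : ancestor a u ≡ root
    x≡root = mutual-ancestors⇒root (i ∸ a) (b ∸ (k ∸ i)) (m<n⇒0<n∸m k∸i<b) x↑y y↑x

  upDown-least-up : ∀ {u v k f i} → SimplePath u v k f → UpDown u v k f i →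
                    ∀ {a b} → ancestor a u ≡ ancestor b v → i ≤ a
  upDown-least-up {u} {v} {k} {f} {i} P D {a} {b} meet = ≮⇒≥ a≮i
    where
    open SimplePath P
    open UpDown D
    a≮i : ¬ a < i
    a≮i a<i with b ≤? k ∸ i
    ... | yes b≤k∸i = <⇒≢ (<-≤-trans a<i (subst (_≤ k ∸ b) (m∸[m∸n]≡n peak≤k) (∸-monoʳ-≤ k b≤k∸i)))
          (simple a (k ∸ b) a≤k (m∸n≤m k b) (trans (up a (<⇒≤ a<i)) (trans meet (sym (down b b≤k∸i)))))
      where a≤k = ≤-trans (<⇒≤ a<i) peak≤k
    ... | no b≰k∸i = <⇒≢ a<i
          (simple a i (≤-trans (<⇒≤ a<i) peak≤k) peak≤k (upDown-overshoot D (<⇒≤ a<i) (≰⇒> b≰k∸i) meet))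

  upDown-least-down : ∀ {u v k f i} → SimplePath u v k f → UpDown u v k f i →
                      ∀ {b} → ancestor i u ≡ ancestor b v → k ∸ i ≤ b
  upDown-least-down {u} {v} {k} {f} {i} P D {b} meet with k ∸ i ≤? b
  ... | yes k∸i≤b = k∸i≤b
  ... | no k∸i≰b = contradiction
          (simple (k ∸ b) i (m∸n≤m k b) peak≤k (trans (down b (<⇒≤ b<k∸i)) (trans (sym meet) (sym (up i ≤-refl)))))
          (<⇒≢ (subst (_< k ∸ b) (m∸[m∸n]≡n peak≤k) (∸-monoʳ-< b<k∸i (m∸n≤m k i))) ∘ sym)
    where
    open SimplePath P
    open UpDown D
    b<k∸i = ≰⇒> k∸i≰b

  upDown-agree : ∀ {u v k f g i} → UpDown u v k f i → UpDown u v k g i → ∀ t → t ≤ k → f t ≡ g t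
  upDown-agree {v = v} {k} {f} {g} {i} D D′ t t≤k with t ≤? i
  ... | yes t≤i = trans (UpDown.up D t t≤i) (sym (UpDown.up D′ t t≤i))
  ... | no t≰i = begin
    f t                ≡⟨ cong f (sym k∸[k∸t]≡t) ⟩
    f (k ∸ (k ∸ t))    ≡⟨ UpDown.down D (k ∸ t) k∸t≤k∸i ⟩
    ancestor (k ∸ t) v ≡⟨ sym (UpDown.down D′ (k ∸ t) k∸t≤k∸i) ⟩
    g (k ∸ (k ∸ t))    ≡⟨ cong g k∸[k∸t]≡t ⟩
    g t                ∎
    where
    open ≡-Reasoning
    k∸[k∸t]≡t = m∸[m∸n]≡n t≤k
    k∸t≤k∸i = ∸-monoʳ-≤ k (<⇒≤ (≰⇒> t≰i))

  -- Both paths have the same peak (the least climb meeting v's ancestors) and the same descent.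
  simplePath-unique : ∀ {u v k k′ f g} → SimplePath u v k f → SimplePath u v k′ g →
                      k ≡ k′ × (∀ t → t ≤ k → f t ≡ g t)
  simplePath-unique {k = k} {k′} P Q with simplePath⇒upDown k P | simplePath⇒upDown k′ Q
  ... | i , D | i′ , D′
    with ≤-antisym (upDown-least-up P D {b = k′ ∸ i′} (upDown-meet D′))
                   (upDown-least-up Q D′ {b = k ∸ i} (upDown-meet D))
  ... | refl
    with ∸-cancelʳ-≡ (UpDown.peak≤k D) (UpDown.peak≤k D′)
           (≤-antisym (upDown-least-down P D (upDown-meet D′)) (upDown-least-down Q D′ (upDown-meet D)))
  ... | refl = refl , upDown-agree D D′

clamp : ∀ k → ℕ → Fin (suc k)
clamp zero    t       = zero
clamp (suc k) zero    = zero
clamp (suc k) (suc t) = suc (clamp k t)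

toℕ-clamp : ∀ {k t} → t ≤ k → toℕ (clamp k t) ≡ t
toℕ-clamp {zero}  z≤n       = refl
toℕ-clamp {suc k} z≤n       = refl
toℕ-clamp {suc k} (s≤s t≤k) = cong suc (toℕ-clamp t≤k)

clamp-toℕ : ∀ {k} (a : Fin (suc k)) → clamp k (toℕ a) ≡ a
clamp-toℕ {zero}  zero    = refl
clamp-toℕ {suc k} zero    = refl
clamp-toℕ {suc k} (suc a) = cong suc (clamp-toℕ a)

-- p read as a sequence on ℕ; it stays at p k beyond the end.
pathℕ : ∀ {k} {B : Set} → (Fin (suc k) → B) → ℕ → B
pathℕ {k} p = p ∘ clamp k

pathℕ-toℕ : ∀ {k} {B : Set} (p : Fin (suc k) → B) (a : Fin (suc k)) → pathℕ p (toℕ a) ≡ p a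
pathℕ-toℕ p a = cong p (clamp-toℕ a)

pathℕ-step : ∀ {k} {B : Set} (p : Fin (suc k) → B) (s : Fin k) →
             pathℕ p (toℕ s) ≡ p (inject₁ s) × pathℕ p (suc (toℕ s)) ≡ p (suc s)
pathℕ-step p s =
  trans (cong (pathℕ p) (sym (Fin.toℕ-inject₁ s))) (pathℕ-toℕ p (inject₁ s)) , pathℕ-toℕ p (suc s)

module _ {n m : ℕ} (I : Instance n m) where
  open Instance I
  open ParentTree parent root parent-root reaches-root

  isPath⇒simplePath : ∀ {u v k p} → IsPath I u v k p → SimplePath u v k (pathℕ p)
  isPath⇒simplePath {k = k} {p} P = record
    { start  = trans (pathℕ-toℕ p zero) start
    ; end    = trans (cong (pathℕ p) (sym (Fin.toℕ-fromℕ k))) (trans (pathℕ-toℕ p (fromℕ k)) end)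
    ; steps  = λ t t<k → subst (λ t → Adj (pathℕ p t) (pathℕ p (suc t))) (Fin.toℕ-fromℕ< t<k)
                             (adjacent (fromℕ< t<k))
    ; simple = λ t t′ t≤k t′≤k eq → trans (sym (toℕ-clamp t≤k)) (trans (cong toℕ (simple _ _ eq)) (toℕ-clamp t′≤k))
    }
    where
    open IsPath P
    arcOfStep⇒adj : ∀ {a b c} → ArcOfStep I a b c → Adj a b
    arcOfStep⇒adj (inj₁ (_ , _ , up))   = inj₁ up
    arcOfStep⇒adj (inj₂ (_ , _ , down)) = inj₂ down
    adjacent : ∀ s → Adj (pathℕ p (toℕ s)) (pathℕ p (suc (toℕ s)))
    adjacent s = subst₂ Adj (sym (proj₁ (pathℕ-step p s))) (sym (proj₂ (pathℕ-step p s)))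
                   (arcOfStep⇒adj (proj₂ (steps s)))

  StepCovers : ∀ {k} → (Fin (suc k) → Fin n) → Fin k → Fin n → Set
  StepCovers p s c = CoveredStep I (p (inject₁ s)) (p (suc s)) c

  coveredStep? : ∀ a b → Dec (∃[ c ] CoveredStep I a b c)
  coveredStep? a b = map′ witness forget
    ((¬? (a Fin.≟ root) ×-dec (parent a Fin.≟ b) ×-dec (upward a Bool.≟ false)) ⊎-dec
     (¬? (b Fin.≟ root) ×-dec (parent b Fin.≟ a) ×-dec (upward b Bool.≟ true)))
    where
    witness : _ → ∃[ c ] CoveredStep I a b c
    witness (inj₁ down) = a , inj₁ (refl , down)
    witness (inj₂ up)   = b , inj₂ (refl , up)
    forget : ∃[ c ] CoveredStep I a b c → _
    forget (_ , inj₁ (_ , down)) = inj₁ down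
    forget (_ , inj₂ (_ , up))   = inj₂ up

  stepCovers? : ∀ {k} (p : Fin (suc k) → Fin n) → Decidable (Marked (StepCovers p))
  stepCovers? p s = coveredStep? (p (inject₁ s)) (p (suc s))

  record EmbeddedAt {k k′} (q : Fin (suc k′) → Fin n) (p : Fin (suc k) → Fin n) (o : ℕ) : Set where
    field
      fits  : o + k′ ≤ k
      agree : ∀ t → t ≤ k′ → pathℕ q t ≡ pathℕ p (o + t)

  shadow-embeds : ∀ {ℓ′ ℓ} → Shadow I ℓ′ ℓ →
    ∃[ k ] Σ (Fin (suc k) → Fin n) λ p → IsLinkPath I ℓ k p ×
    ∃[ o ] (∀ {k′ q} → IsLinkPath I ℓ′ k′ q → EmbeddedAt q p o)
  shadow-embeds {ℓ′} (k , p , P , i , j , i<j , pi≡tail , pj≡head) = k , p , P , toℕ i , embeds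
    where
    i≤j = <⇒≤ i<j
    j≤k = Fin.toℕ≤pred[n] j
    piece : SimplePath (tail ℓ′) (head ℓ′) (toℕ j ∸ toℕ i) (λ t → pathℕ p (toℕ i + t))
    piece = subst₂ (λ a b → SimplePath a b _ _)
              (trans (pathℕ-toℕ p i) pi≡tail) (trans (pathℕ-toℕ p j) pj≡head)
              (slice (isPath⇒simplePath P) i≤j j≤k)
    embeds : ∀ {k′ q} → IsLinkPath I ℓ′ k′ q → EmbeddedAt q p (toℕ i)
    embeds Q with simplePath-unique (isPath⇒simplePath Q) piece
    ... | refl , agree = record { fits = ≤-trans (≤-reflexive (m+[n∸m]≡n i≤j)) j≤k ; agree = agree }

  module _ {k k′ o} {q : Fin (suc k′) → Fin n} {p : Fin (suc k) → Fin n} (E : EmbeddedAt q p o) where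
    open EmbeddedAt E

    embedded-step : ∀ {s c} → StepCovers q s c → ∃[ s′ ] toℕ s′ ≡ o + toℕ s × StepCovers p s′ c
    embedded-step {s} {c} covers = s′ , s′≡o+s , subst₂ (λ a b → CoveredStep I a b c) from-eq to-eq covers
      where
      s<k′ = Fin.toℕ<n s
      o+s<k = <-≤-trans (+-monoʳ-< o s<k′) fits
      s′ = fromℕ< o+s<k
      s′≡o+s = Fin.toℕ-fromℕ< o+s<k
      from-eq : q (inject₁ s) ≡ p (inject₁ s′)
      from-eq = begin
        q (inject₁ s)       ≡⟨ sym (proj₁ (pathℕ-step q s)) ⟩
        pathℕ q (toℕ s)     ≡⟨ agree (toℕ s) (<⇒≤ s<k′) ⟩
        pathℕ p (o + toℕ s) ≡⟨ cong (pathℕ p) (sym s′≡o+s) ⟩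
        pathℕ p (toℕ s′)    ≡⟨ proj₁ (pathℕ-step p s′) ⟩
        p (inject₁ s′)      ∎
        where open ≡-Reasoning
      to-eq : q (suc s) ≡ p (suc s′)
      to-eq = begin
        q (suc s)                 ≡⟨ sym (proj₂ (pathℕ-step q s)) ⟩
        pathℕ q (suc (toℕ s))     ≡⟨ agree (suc (toℕ s)) s<k′ ⟩
        pathℕ p (o + suc (toℕ s)) ≡⟨ cong (pathℕ p) (trans (+-suc o (toℕ s)) (cong suc (sym s′≡o+s))) ⟩
        pathℕ p (suc (toℕ s′))    ≡⟨ proj₂ (pathℕ-step p s′) ⟩
        p (suc s′)                ∎
        where open ≡-Reasoning

    embedded-marked : ∀ {s} → Marked (StepCovers q) s → ∃[ s′ ] Marked (StepCovers p) s′ × toℕ s′ ≡ o + toℕ s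
    embedded-marked (c , covers) with embedded-step covers
    ... | s′ , s′≡o+s , covers′ = s′ , (c , covers′) , s′≡o+s

    embedded-vertex : ∀ t → p (clamp k (o + toℕ t)) ≡ q t
    embedded-vertex t = trans (sym (agree (toℕ t) (Fin.toℕ≤pred[n] t))) (pathℕ-toℕ q t)

    embedded-straddles : ∀ t → Straddles (StepCovers q) t → Straddles (StepCovers p) (clamp k (o + toℕ t))
    embedded-straddles t ((s₁ , m₁ , s₁<t) , (s₂ , m₂ , t≤s₂))
      with embedded-marked m₁ | embedded-marked m₂
    ... | s₁′ , m₁′ , s₁′≡ | s₂′ , m₂′ , s₂′≡ =
      (s₁′ , m₁′ , subst₂ _<_ (sym s₁′≡) (sym t′≡) (+-monoʳ-< o s₁<t)) ,
      (s₂′ , m₂′ , subst₂ _≤_ (sym t′≡) (sym s₂′≡) (+-monoʳ-≤ o t≤s₂))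
      where
      t′≡ : toℕ (clamp k (o + toℕ t)) ≡ o + toℕ t
      t′≡ = toℕ-clamp (≤-trans (+-monoʳ-≤ o (Fin.toℕ≤pred[n] t)) fits)

  shadow-inCov : ∀ {ℓ′ ℓ c} → Shadow I ℓ′ ℓ → InCov I ℓ′ c → InCov I ℓ c
  shadow-inCov sh (k′ , q , Q , s , covers) with shadow-embeds sh
  ... | k , p , P , o , embeds with embedded-step (embeds Q) covers
  ... | s′ , _ , covers′ = k , p , P , s′ , covers′

  innerOfBar⇒straddled : ∀ {ℓ v} → InnerOfBar I ℓ v →
    ∃[ k ] Σ (Fin (suc k) → Fin n) λ p → IsLinkPath I ℓ k p × ∃[ t ] Straddles (StepCovers p) t × p t ≡ v
  innerOfBar⇒straddled (k , p , P , i , j , tightest , t , i<t , t<j , pt≡v) =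
    k , p , P , t , tightest-inner⇒straddles (StepCovers p) (stepCovers? p) tightest i<t t<j , pt≡v

  straddled⇒innerOfBar : ∀ {ℓ v k} {p : Fin (suc k) → Fin n} {t} → IsLinkPath I ℓ k p →
    Straddles (StepCovers p) t → p t ≡ v → InnerOfBar I ℓ v
  straddled⇒innerOfBar {k = k} {p} {t} P straddles pt≡v =
    let i , j , tightest , i<t , t<j = straddles⇒tightest-inner (StepCovers p) (stepCovers? p) straddles
    in k , p , P , i , j , tightest , t , i<t , t<j , pt≡v

  shadow-innerOfBar : ∀ {ℓ′ ℓ v} → Shadow I ℓ′ ℓ → InnerOfBar I ℓ′ v → InnerOfBar I ℓ v
  shadow-innerOfBar sh inner =
    let k′ , q , Q , t , straddles , qt≡v = innerOfBar⇒straddled inner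
        k , p , P , o , embeds = shadow-embeds sh
    in straddled⇒innerOfBar P (embedded-straddles (embeds Q) t straddles)
                               (trans (embedded-vertex (embeds Q) t) qt≡v)

  visible-shadow-mono : ∀ {L L′ : Fin m → Set} {v c} →
    (∀ {ℓ′} → L′ ℓ′ → ∃[ ℓ ] L ℓ × Shadow I ℓ′ ℓ) → Visible I L′ v c → Visible I L v c
  visible-shadow-mono shadowed (inA , ℓ′ , L′ℓ′ , covers , inner) with shadowed L′ℓ′
  ... | ℓ , Lℓ , sh = inA , ℓ , Lℓ , shadow-inCov sh covers , shadow-innerOfBar sh inner

  visibleWidth-mono : ∀ (K : Fin n → Set) {L L′ : Fin m → Set} {v w w′} →
    (∀ {c} → Visible I L′ v c → Visible I L v c) →
    IsVisibleWidth I K L′ v w′ → IsVisibleWidth I K L v w → w′ ≤ w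
  visibleWidth-mono K visible ((F , (kinds , ancestor-free) , ∣F∣≡w′) , _) (_ , maximal) =
    subst (_≤ _) ∣F∣≡w′ (maximal F ((λ c c∈F → proj₁ (kinds c c∈F) , visible (proj₂ (kinds c c∈F))) , ancestor-free))

  split-supp⇒shadow : ∀ {x σ} → IsSplitting I σ →
    ∀ {ℓ′} → supp I (split I x σ) ℓ′ → ∃[ ℓ ] supp I x ℓ × Shadow I ℓ′ ℓ
  split-supp⇒shadow {x} {σ} σ-splits {ℓ′} pos with sumℚ-pos⇒∃-pos _ pos
  ... | ℓ , pos-ℓ with lookup (σ ℓ) ℓ′ in ℓ′∈σℓ
  ...   | true  = ℓ , pos-ℓ , proj₁ (σ-splits ℓ) ℓ′ (lookup⇒[]= ℓ′ (σ ℓ) ℓ′∈σℓ)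
  ...   | false = contradiction pos-ℓ (ℚ.<-irrefl refl)

proposition7p4 : ∀ {n m : ℕ} (I : Instance n m)
    (M : Fin n → Fin m → ℚ) → IsCoverageMatrix I M →
    (x : Fin m → ℚ) → Feasible I M x →
    (σ : Fin m → Subset m) → IsSplitting I σ →
    ∀ (v : Fin n) →
      (∀ w w' → IsVisibleUpWidth I (supp I (split I x σ)) v w' →
                IsVisibleUpWidth I (supp I x) v w → w' ≤ w)
      × (∀ w w' → IsVisibleDownWidth I (supp I (split I x σ)) v w' →
                  IsVisibleDownWidth I (supp I x) v w → w' ≤ w)
proposition7p4 I _ _ x _ σ σ-splits v = width-mono (UpArc I) , width-mono (DownArc I)
  where
  visible : ∀ {c} → Visible I (supp I (split I x σ)) v c → Visible I (supp I x) v c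
  visible = visible-shadow-mono I (split-supp⇒shadow I σ-splits)
  width-mono : ∀ K w w′ → IsVisibleWidth I K (supp I (split I x σ)) v w′ →
               IsVisibleWidth I K (supp I x) v w → w′ ≤ w
  width-mono K _ _ = visibleWidth-mono I K visible
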